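{- Let $\mathcal{P}_\infty=\{l_{i_1},\dots,l_{i_6}\}$ be six lines in $\mathbb{P}^2(\mathbb{R})$ in general position whose only nontrivial collinearities are the three Pappus collinearities $\mathcal{C}_1=\{P_{i_1i_2},P_{i_3i_4},P_{i_5i_6}\}$, $\mathcal{C}_2=\{P_{i_2i_4},P_{i_1i_6},P_{i_3i_5}\}$, $\mathcal{C}_3=\{P_{i_1i_3},P_{i_2i_5},P_{i_4i_6}\}$, where $P_{ab}=l_a\cap l_b$. An element $\sigma\in S\subseteq S_6$ acts strongly on $\mathcal{L}_2(\mathcal{P}_\infty)$ if and only if $\sigma$ is a product of exactly three (pairwise disjoint) transpositions $\tau_{a_1b_1}\tau_{a_2b_2}\tau_{a_3b_3}$ such that the three points $P_{a_1b_1},P_{a_2b_2},P_{a_3b_3}$ fixed by them lie one in each of the three distinct collinearities $\mathcal{C}_1,\mathcal{C}_2,\mathcal{C}_3$.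
   Context: $\mathcal{L}_2(\mathcal{P}_\infty)$ is the set of the $15$ double points $P_{ab}$. $S\subseteq S_6$ is the set of permutations that are products of pairwise disjoint transpositions; $\sigma\in S$ acts on double points by $\sigma.P_{ab}=l_{\sigma(a)}\cap l_{\sigma(b)}$. A nontrivial collinearity is a set of at least three collinear double points no two of which lie on a common line of the arrangement. $\sigma$ acts strongly on the arrangement if for every nontrivial collinearity $\{P_1,\dots,P_m\}$ one has $\sigma.P_j\in\{P_1,\dots,P_m\}$ for all $j$. -}

module Defs where

open import Data.Fin using (Fin; #_)
open import Data.Fin.Permutation using (Permutation′; _⟨$⟩ʳ_; transpose; id; _∘ₚ_)
open import Data.Product using (_×_; _,_; Σ; ∃)
open import Data.Sum using (_⊎_)
open import Data.List using (List; []; _∷_; length; concatMap)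
open import Data.List.Relation.Unary.Any using (Any)
open import Data.List.Relation.Unary.All using (All)
open import Data.List.Relation.Unary.AllPairs using (AllPairs)
open import Data.Nat using (ℕ; _≤_)
open import Relation.Binary.PropositionalEquality using (_≡_; _≢_)
open import Relation.Nullary using (¬_)

Line : Set
Line = Fin 6

-- A double point P_ab = l_a ∩ l_b is represented by the pair (a , b), a ≢ b.
-- (a , b) and (b , a) denote the same double point.
DPt : Set
DPt = Line × Line

IsDP : DPt → Set
IsDP (a , b) = a ≢ b

_≈P_ : DPt → DPt → Set
(a , b) ≈P (c , d) = (a ≡ c × b ≡ d) ⊎ (a ≡ d × b ≡ c)

_∈P_ : DPt → List DPt → Set
p ∈P L = Any (p ≈P_) L

SameSet : List DPt → List DPt → Set
SameSet L M = (∀ p → p ∈P L → p ∈P M) × (∀ p → p ∈P M → p ∈P L)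

ShareLine : DPt → DPt → Set
ShareLine (a , b) (c , d) = (a ≡ c ⊎ a ≡ d) ⊎ (b ≡ c ⊎ b ≡ d)

-- Col L : "the double points in L are collinear" (the incidence data of the
-- arrangement, kept abstract).
NontrivialCollinearity : (List DPt → Set) → List DPt → Set
NontrivialCollinearity Col L =
  All IsDP L × (3 ≤ length L) × AllPairs (λ p q → ¬ ShareLine p q) L × Col L

-- The Pappus collinearities for the labelling i_1..i_6 = ι(0)..ι(5)
-- (positions 1..6 of the paper are # 0 .. # 5 here).
module _ (ι : Permutation′ 6) where
  private
    i : Fin 6 → Line
    i k = ι ⟨$⟩ʳ k

  C₁ : List DPt
  C₁ = (i (# 0) , i (# 1)) ∷ (i (# 2) , i (# 3)) ∷ (i (# 4) , i (# 5)) ∷ []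

  C₂ : List DPt
  C₂ = (i (# 1) , i (# 3)) ∷ (i (# 0) , i (# 5)) ∷ (i (# 2) , i (# 4)) ∷ []

  C₃ : List DPt
  C₃ = (i (# 0) , i (# 2)) ∷ (i (# 1) , i (# 4)) ∷ (i (# 3) , i (# 5)) ∷ []

OnlyPappusCollinearities : (List DPt → Set) → Permutation′ 6 → Set
OnlyPappusCollinearities Col ι =
  (∀ L → NontrivialCollinearity Col L →
     SameSet L (C₁ ι) ⊎ SameSet L (C₂ ι) ⊎ SameSet L (C₃ ι))
  × NontrivialCollinearity Col (C₁ ι)
  × NontrivialCollinearity Col (C₂ ι)
  × NontrivialCollinearity Col (C₃ ι)

act : Permutation′ 6 → DPt → DPt
act σ (a , b) = (σ ⟨$⟩ʳ a , σ ⟨$⟩ʳ b)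

ActsStrongly : (List DPt → Set) → Permutation′ 6 → Set
ActsStrongly Col σ =
  ∀ L → NontrivialCollinearity Col L → All (λ p → act σ p ∈P L) L

prodT : List (Fin 6 × Fin 6) → Permutation′ 6
prodT [] = id
prodT ((a , b) ∷ ts) = transpose a b ∘ₚ prodT ts

entries : List (Fin 6 × Fin 6) → List (Fin 6)
entries = concatMap (λ { (a , b) → a ∷ b ∷ [] })

IsProdDisjTransp : List (Fin 6 × Fin 6) → Permutation′ 6 → Set
IsProdDisjTransp ts σ =
  AllPairs _≢_ (entries ts) × (∀ x → σ ⟨$⟩ʳ x ≡ prodT ts ⟨$⟩ʳ x)

-- the set S ⊆ S₆: products of (at least one) pairwise disjoint transpositions.
-- The identity (empty product) is excluded: it trivially acts strongly, so
-- the lemma would be false otherwise.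
InS : Permutation′ 6 → Set
InS σ = ∃ λ ts → (1 ≤ length ts) × IsProdDisjTransp ts σ

{-# OPTIONS --safe #-}
-- Since C₁, C₂, C₃ are, up to set equality, all the nontrivial collinearities, σ acts
-- strongly exactly when it maps each Cᵢ into itself.  Conjugating by the labelling ι
-- reduces this to the standard labelling i_k = k.  There, a product of disjoint
-- transpositions of six letters has at most three factors, and an exhaustive search shows
-- that the ones preserving C₁, C₂, C₃ are exactly τ₀₁τ₂₄τ₃₅, τ₂₃τ₀₅τ₁₄ and τ₄₅τ₁₃τ₀₂,
-- while every product of three disjoint transpositions through one point of each Cᵢ
-- preserves them.
module Submission where

open import Defs
open import Data.Fin using (Fin; #_; zero; suc)
open import Data.Fin.Properties using (_≟_; all?; injective⇒≤)
open import Data.Fin.Permutation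
  using (Permutation; Permutation′; _⟨$⟩ʳ_; _⟨$⟩ˡ_; _∘ₚ_; flip; id; _≈_; inverseˡ; inverseʳ)
import Data.Fin.Permutation.Components as PC
open import Data.Product using (_×_; _,_; proj₁; proj₂; ∃-syntax)
open import Data.Sum using (inj₁; inj₂; [_,_]′)
open import Data.Nat using (ℕ; zero; suc; _≤_; _≤?_; _+_; _*_; s≤s)
import Data.Nat.Properties as ℕ
open import Data.List using (List; []; _∷_; map; length; lookup)
open import Data.List.Properties using (map-cong; length-map)
open import Data.List.Membership.Propositional.Properties using (∈-lookup)
open import Data.List.Membership.Propositional using (_∉_)
open import Data.List.Membership.DecPropositional {A = Line} _≟_ using (_∉?_)
open import Data.List.Relation.Unary.Any as Any using (Any; here; there)
import Data.List.Relation.Unary.Any.Properties as Any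
open import Data.List.Relation.Unary.All as All using (All; []; _∷_)
import Data.List.Relation.Unary.All.Properties as All
open import Data.List.Relation.Unary.AllPairs as AllPairs using (AllPairs; _∷_)
import Data.List.Relation.Unary.AllPairs.Properties as AllPairs
open import Data.List.Relation.Binary.Pointwise as Pointwise using (Pointwise; []; _∷_)
open import Function using (_∘_)
open import Function.Bundles using (_⇔_; mk⇔)
open import Function.Construct.Composition using (_⇔-∘_)
open import Function.Construct.Symmetry using (⇔-sym)
open import Function.Definitions using (Injective)
open import Relation.Binary.PropositionalEquality
  using (_≡_; _≢_; _≗_; refl; sym; trans; cong; cong₂; subst; module ≡-Reasoning)
open import Relation.Nullary using (Dec; yes; no; ¬?; contradiction)
open import Relation.Nullary.Decidable using (True; toWitness; _×-dec_; _⊎-dec_; _→-dec_; from-yes)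

image : (Line → Line) → DPt → DPt
image f (a , b) = (f a , f b)

relabel : (Line → Line) → List DPt → List DPt
relabel f = map (image f)

image-cong : ∀ {f g} → f ≗ g → image f ≗ image g
image-cong f≗g (a , b) = cong₂ _,_ (f≗g a) (f≗g b)

≈P-refl : ∀ p → p ≈P p
≈P-refl (a , b) = inj₁ (refl , refl)

≈P-trans : ∀ {p q r} → p ≈P q → q ≈P r → p ≈P r
≈P-trans (inj₁ (refl , refl)) q≈r                  = q≈r
≈P-trans (inj₂ (refl , refl)) (inj₁ (refl , refl)) = inj₂ (refl , refl)
≈P-trans (inj₂ (refl , refl)) (inj₂ (refl , refl)) = inj₁ (refl , refl)

≈P-image : ∀ f {p q} → p ≈P q → image f p ≈P image f q
≈P-image f (inj₁ (refl , refl)) = inj₁ (refl , refl)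
≈P-image f (inj₂ (refl , refl)) = inj₂ (refl , refl)

∈P-resp-≈P : ∀ {p q L} → p ≈P q → q ∈P L → p ∈P L
∈P-resp-≈P p≈q = Any.map (≈P-trans p≈q)

∈P-relabel : ∀ f {p L} → p ∈P L → image f p ∈P relabel f L
∈P-relabel f = Any.map⁺ ∘ Any.map (≈P-image f)

_≈P?_ : ∀ p q → Dec (p ≈P q)
(a , b) ≈P? (c , d) = ((a ≟ c) ×-dec (b ≟ d)) ⊎-dec ((a ≟ d) ×-dec (b ≟ c))

_∈P?_ : ∀ p L → Dec (p ∈P L)
p ∈P? L = Any.any? (p ≈P?_) L

PreservedBy : (Line → Line) → List DPt → Set
PreservedBy h L = All (λ p → image h p ∈P L) L

preservedBy? : ∀ h L → Dec (PreservedBy h L)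
preservedBy? h L = All.all? (λ p → image h p ∈P? L) L

∈P-preservedBy : ∀ {h L p} → PreservedBy h L → p ∈P L → image h p ∈P L
∈P-preservedBy {h} pres p∈L with All.lookupAny pres p∈L
... | hq∈L , p≈q = ∈P-resp-≈P (≈P-image h p≈q) hq∈L

preservedBy-sameSet : ∀ {h L M} → SameSet L M → PreservedBy h M → PreservedBy h L
preservedBy-sameSet {L = L} (L⊆M , M⊆L) pres =
  All.tabulate λ {p} p∈L →
    M⊆L _ (∈P-preservedBy pres (L⊆M p (Any.map (λ { refl → ≈P-refl p }) p∈L)))

preservedBy-cong : ∀ {h k L} → h ≗ k → PreservedBy h L → PreservedBy k L
preservedBy-cong {L = L} h≗k = All.map λ {p} → subst (_∈P L) (image-cong h≗k p)

-- conjugate π σ ⟨$⟩ʳ x = π⁻¹ (σ (π x)), as _∘ₚ_ composes left to right.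
conjugate : ∀ {n} → Permutation′ n → Permutation′ n → Permutation′ n
conjugate π σ = π ∘ₚ σ ∘ₚ flip π

conjugate-flip : ∀ {n} (π σ : Permutation′ n) → conjugate (flip π) (conjugate π σ) ≈ σ
conjugate-flip π σ x = trans (inverseʳ π) (cong (σ ⟨$⟩ʳ_) (inverseʳ π))

preservedBy-conjugate : ∀ π σ {L} → PreservedBy (σ ⟨$⟩ʳ_) L →
  PreservedBy (conjugate π σ ⟨$⟩ʳ_) (relabel (π ⟨$⟩ˡ_) L)
preservedBy-conjugate π σ {L} = All.map⁺ ∘ All.map conjugate-∈P
  where
  conjugate-∈P : ∀ {p} → image (σ ⟨$⟩ʳ_) p ∈P L →
    image (conjugate π σ ⟨$⟩ʳ_) (image (π ⟨$⟩ˡ_) p) ∈P relabel (π ⟨$⟩ˡ_) L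
  conjugate-∈P {a , b} σp∈L =
    subst (_∈P relabel (π ⟨$⟩ˡ_) L) (cong₂ _,_ (unconjugate a) (unconjugate b))
          (∈P-relabel (π ⟨$⟩ˡ_) σp∈L)
    where
    unconjugate : ∀ x → π ⟨$⟩ˡ (σ ⟨$⟩ʳ x) ≡ π ⟨$⟩ˡ (σ ⟨$⟩ʳ (π ⟨$⟩ʳ (π ⟨$⟩ˡ x)))
    unconjugate x = cong (λ y → π ⟨$⟩ˡ (σ ⟨$⟩ʳ y)) (sym (inverseʳ π))

pappusCollinearities : Permutation′ 6 → List (List DPt)
pappusCollinearities ι = C₁ ι ∷ C₂ ι ∷ C₃ ι ∷ []

-- pappusCollinearities ι is definitionally the relabelling of pappusCollinearities id by ι.
pappusCollinearities-cong : ∀ {ι ι′} → ι ≈ ι′ → pappusCollinearities ι ≡ pappusCollinearities ι′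
pappusCollinearities-cong ι≈ι′ =
  map-cong (map-cong (image-cong ι≈ι′)) (pappusCollinearities id)

PreservesPappus : Permutation′ 6 → Permutation′ 6 → Set
PreservesPappus ι σ = All (PreservedBy (σ ⟨$⟩ʳ_)) (pappusCollinearities ι)

actsStrongly⇔preservesPappus : ∀ {Col ι σ} → OnlyPappusCollinearities Col ι →
  ActsStrongly Col σ ⇔ PreservesPappus ι σ
actsStrongly⇔preservesPappus (onlyPappus , nc₁ , nc₂ , nc₃) = mk⇔
  (λ strong → strong _ nc₁ ∷ strong _ nc₂ ∷ strong _ nc₃ ∷ [])
  (λ { (pres₁ ∷ pres₂ ∷ pres₃ ∷ []) L nc →
       [ (λ L≃C₁ → preservedBy-sameSet L≃C₁ pres₁)
       , [ (λ L≃C₂ → preservedBy-sameSet L≃C₂ pres₂)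
         , (λ L≃C₃ → preservedBy-sameSet L≃C₃ pres₃) ]′ ]′ (onlyPappus L nc) })

preservesPappus-resp-≈ : ∀ {ι ι′ σ σ′} → ι ≈ ι′ → σ ≈ σ′ →
  PreservesPappus ι σ → PreservesPappus ι′ σ′
preservesPappus-resp-≈ {ι} {ι′} {σ′ = σ′} ι≈ι′ σ≈σ′ =
  subst (All (PreservedBy (σ′ ⟨$⟩ʳ_))) (pappusCollinearities-cong {ι} {ι′} ι≈ι′) ∘
  All.map (preservedBy-cong σ≈σ′)

preservesPappus-conjugate : ∀ π ι σ → PreservesPappus ι σ →
  PreservesPappus (ι ∘ₚ flip π) (conjugate π σ)
preservesPappus-conjugate π ι σ = All.map⁺ ∘ All.map (preservedBy-conjugate π σ)

preservesPappus-standardise : ∀ ι σ → PreservesPappus ι σ ⇔ PreservesPappus id (conjugate ι σ)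
preservesPappus-standardise ι σ = mk⇔
  (preservesPappus-resp-≈ {ι ∘ₚ flip ι} {id} {conjugate ι σ} {conjugate ι σ}
     (λ _ → inverseˡ ι) (λ _ → refl) ∘ preservesPappus-conjugate ι ι σ)
  (preservesPappus-resp-≈ {id ∘ₚ flip (flip ι)} {ι} {conjugate (flip ι) (conjugate ι σ)} {σ}
     (λ _ → refl) (conjugate-flip ι σ) ∘ preservesPappus-conjugate (flip ι) id (conjugate ι σ))

Disjoint : List (Line × Line) → Set
Disjoint ts = AllPairs _≢_ (entries ts)

lookup-injective : ∀ {n} {xs : List (Fin n)} → AllPairs _≢_ xs →
  ∀ i j → lookup xs i ≡ lookup xs j → i ≡ j
lookup-injective (_ ∷ _)   zero    zero    _  = refl
lookup-injective (x≢ ∷ _)  zero    (suc j) eq = contradiction eq (All.lookup x≢ (∈-lookup j))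
lookup-injective (x≢ ∷ _)  (suc i) zero    eq = contradiction (sym eq) (All.lookup x≢ (∈-lookup i))
lookup-injective (_ ∷ xs≢) (suc i) (suc j) eq = cong suc (lookup-injective xs≢ i j eq)

distinct⇒length≤ : ∀ {n} {xs : List (Fin n)} → AllPairs _≢_ xs → length xs ≤ n
distinct⇒length≤ xs≢ = injective⇒≤ (lookup-injective xs≢ _ _)

transpose-relabel : ∀ {m n} (f : Fin m → Fin n) → Injective _≡_ _≡_ f →
  ∀ i j k → PC.transpose (f i) (f j) (f k) ≡ f (PC.transpose i j k)
transpose-relabel f f-inj i j k with k ≟ i | f k ≟ f i
... | yes _   | yes _    = refl
... | yes k≡i | no fk≢fi = contradiction (cong f k≡i) fk≢fi
... | no k≢i  | yes fk≡fi = contradiction (f-inj fk≡fi) k≢i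
... | no _    | no _ with k ≟ j | f k ≟ f j
...   | yes _   | yes _    = refl
...   | yes k≡j | no fk≢fj = contradiction (cong f k≡j) fk≢fj
...   | no k≢j  | yes fk≡fj = contradiction (f-inj fk≡fj) k≢j
...   | no _    | no _     = refl

prodT-relabel : ∀ f → Injective _≡_ _≡_ f → ∀ ts x →
  prodT (relabel f ts) ⟨$⟩ʳ f x ≡ f (prodT ts ⟨$⟩ʳ x)
prodT-relabel f f-inj []             x = refl
prodT-relabel f f-inj ((a , b) ∷ ts) x =
  trans (cong (prodT (relabel f ts) ⟨$⟩ʳ_) (transpose-relabel f f-inj a b x))
        (prodT-relabel f f-inj ts (PC.transpose a b x))

entries-relabel : ∀ f ts → entries (relabel f ts) ≡ map f (entries ts)
entries-relabel f []             = refl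
entries-relabel f ((a , b) ∷ ts) = cong (λ es → f a ∷ f b ∷ es) (entries-relabel f ts)

disjoint-relabel : ∀ f → Injective _≡_ _≡_ f → ∀ {ts} → Disjoint ts → Disjoint (relabel f ts)
disjoint-relabel f f-inj {ts} disj = subst (AllPairs _≢_) (sym (entries-relabel f ts))
  (AllPairs.map⁺ (AllPairs.map (λ a≢b → a≢b ∘ f-inj) disj))

⟨$⟩ˡ-injective : ∀ {m n} (π : Permutation m n) → Injective _≡_ _≡_ (π ⟨$⟩ˡ_)
⟨$⟩ˡ-injective π eq = trans (sym (inverseʳ π)) (trans (cong (π ⟨$⟩ʳ_) eq) (inverseʳ π))

isProdDisjTransp-conjugate : ∀ π {ts σ} → IsProdDisjTransp ts σ →
  IsProdDisjTransp (relabel (π ⟨$⟩ˡ_) ts) (conjugate π σ)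
isProdDisjTransp-conjugate π {ts} {σ} (disj , σ≗ts) =
  disjoint-relabel (π ⟨$⟩ˡ_) (⟨$⟩ˡ-injective π) {ts} disj , conjugate≗
  where
  open ≡-Reasoning
  relabelled : Permutation′ 6
  relabelled = prodT (relabel (π ⟨$⟩ˡ_) ts)
  conjugate≗ : ∀ x → conjugate π σ ⟨$⟩ʳ x ≡ relabelled ⟨$⟩ʳ x
  conjugate≗ x = begin
    π ⟨$⟩ˡ (σ ⟨$⟩ʳ (π ⟨$⟩ʳ x))             ≡⟨ cong (π ⟨$⟩ˡ_) (σ≗ts _) ⟩
    π ⟨$⟩ˡ (prodT ts ⟨$⟩ʳ (π ⟨$⟩ʳ x))      ≡⟨ prodT-relabel _ (⟨$⟩ˡ-injective π) ts _ ⟨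
    relabelled ⟨$⟩ʳ (π ⟨$⟩ˡ (π ⟨$⟩ʳ x))    ≡⟨ cong (relabelled ⟨$⟩ʳ_) (inverseˡ π) ⟩
    relabelled ⟨$⟩ʳ x                       ∎

isProdDisjTransp-resp-≈ : ∀ {ts σ σ′} → σ ≈ σ′ → IsProdDisjTransp ts σ → IsProdDisjTransp ts σ′
isProdDisjTransp-resp-≈ σ≈σ′ (disj , σ≗ts) = disj , λ x → trans (sym (σ≈σ′ x)) (σ≗ts x)

inS-conjugate : ∀ π {σ} → InS σ → InS (conjugate π σ)
inS-conjugate π {σ} (ts , nonempty , σ≗ts) =
  relabel (π ⟨$⟩ˡ_) ts ,
  subst (1 ≤_) (sym (length-map (image (π ⟨$⟩ˡ_)) ts)) nonempty ,
  isProdDisjTransp-conjugate π {ts} {σ} σ≗ts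

Transversal : Permutation′ 6 → List (Line × Line) → Set
Transversal ι ts = Pointwise _∈P_ ts (pappusCollinearities ι)

PappusInvolution : Permutation′ 6 → Permutation′ 6 → Set
PappusInvolution ι σ = ∃[ ts ] IsProdDisjTransp ts σ × Transversal ι ts

pappusInvolution-resp-≈ : ∀ {ι ι′ σ σ′} → ι ≈ ι′ → σ ≈ σ′ →
  PappusInvolution ι σ → PappusInvolution ι′ σ′
pappusInvolution-resp-≈ {ι} {ι′} {σ} {σ′} ι≈ι′ σ≈σ′ (ts , σ≗ts , transversal) =
  ts , isProdDisjTransp-resp-≈ {ts} {σ} {σ′} σ≈σ′ σ≗ts ,
  subst (Pointwise _∈P_ ts) (pappusCollinearities-cong {ι} {ι′} ι≈ι′) transversal

pappusInvolution-conjugate : ∀ π ι σ → PappusInvolution ι σ →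
  PappusInvolution (ι ∘ₚ flip π) (conjugate π σ)
pappusInvolution-conjugate π ι σ (ts , σ≗ts , transversal) =
  relabel (π ⟨$⟩ˡ_) ts ,
  isProdDisjTransp-conjugate π {ts} {σ} σ≗ts ,
  Pointwise.map⁺ _ _ (Pointwise.map (∈P-relabel (π ⟨$⟩ˡ_)) transversal)

pappusInvolution-standardise : ∀ ι σ → PappusInvolution ι σ ⇔ PappusInvolution id (conjugate ι σ)
pappusInvolution-standardise ι σ = mk⇔
  (pappusInvolution-resp-≈ {ι ∘ₚ flip ι} {id} {conjugate ι σ} {conjugate ι σ}
     (λ _ → inverseˡ ι) (λ _ → refl) ∘ pappusInvolution-conjugate ι ι σ)
  (pappusInvolution-resp-≈ {id ∘ₚ flip (flip ι)} {ι} {conjugate (flip ι) (conjugate ι σ)} {σ}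
     (λ _ → refl) (conjugate-flip ι σ) ∘ pappusInvolution-conjugate (flip ι) id (conjugate ι σ))

-- P holds of every list of at most k disjoint transpositions whose entries avoid used.
-- Freshness is tested as soon as an entry is chosen, so the search only visits disjoint lists.
ForAllDisjoint : ℕ → List Line → (List (Line × Line) → Set) → Set
ForAllDisjoint zero    used P = P []
ForAllDisjoint (suc k) used P = P [] ×
  (∀ a b → a ∉ used → b ∉ a ∷ used → ForAllDisjoint k (a ∷ b ∷ used) (P ∘ ((a , b) ∷_)))

forAllDisjoint? : ∀ k used {P : List (Line × Line) → Set} → (∀ ts → Dec (P ts)) →
  Dec (ForAllDisjoint k used P)
forAllDisjoint? zero    used P? = P? []
forAllDisjoint? (suc k) used P? = P? [] ×-dec
  all? λ a → all? λ b → a ∉? used →-dec (b ∉? a ∷ used →-dec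
    forAllDisjoint? k (a ∷ b ∷ used) (P? ∘ ((a , b) ∷_)))

∉-∷ : ∀ {A : Set} {x y : A} {ys} → y ≢ x → x ∉ ys → x ∉ y ∷ ys
∉-∷ y≢x x∉ys (here x≡y) = y≢x (sym x≡y)
∉-∷ y≢x x∉ys (there x∈ys) = x∉ys x∈ys

forAllDisjoint-sound : ∀ k used {P : List (Line × Line) → Set} → ForAllDisjoint k used P →
  ∀ ts → length ts ≤ k → Disjoint ts → All (_∉ used) (entries ts) → P ts
forAllDisjoint-sound zero    used holds []             _ _ _ = holds
forAllDisjoint-sound (suc k) used holds []             _ _ _ = proj₁ holds
forAllDisjoint-sound (suc k) used holds ((a , b) ∷ ts) (s≤s length≤k)
  ((a≢b ∷ a≢ts) ∷ b≢ts ∷ disj) (a∉used ∷ b∉used ∷ fresh) =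
  forAllDisjoint-sound k (a ∷ b ∷ used)
    (proj₂ holds a b a∉used (∉-∷ a≢b b∉used)) ts length≤k disj
    (All.zipWith (λ { (a≢x , b≢x , x∉used) → ∉-∷ a≢x (∉-∷ b≢x x∉used) })
                 (a≢ts , All.zip (b≢ts , fresh)))

length-entries : ∀ ts → length (entries ts) ≡ 2 * length ts
length-entries []       = refl
length-entries (_ ∷ ts) = trans (cong (2 +_) (length-entries ts)) (sym (ℕ.*-suc 2 (length ts)))

disjoint⇒length≤3 : ∀ ts → Disjoint ts → length ts ≤ 3
disjoint⇒length≤3 ts disj =
  ℕ.*-cancelˡ-≤ 2 (subst (_≤ 6) (length-entries ts) (distinct⇒length≤ disj))

byDisjointSearch : ∀ {P : List (Line × Line) → Set} (P? : ∀ ts → Dec (P ts)) →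
  True (forAllDisjoint? 3 [] P?) → ∀ ts → Disjoint ts → P ts
byDisjointSearch {P} P? found ts disj = forAllDisjoint-sound 3 [] {P} (toWitness found) ts
  (disjoint⇒length≤3 ts disj) disj (All.universal (λ _ ()) (entries ts))

pappusTriples : List (List (Line × Line))
pappusTriples =
  ((# 0 , # 1) ∷ (# 2 , # 4) ∷ (# 3 , # 5) ∷ []) ∷
  ((# 2 , # 3) ∷ (# 0 , # 5) ∷ (# 1 , # 4) ∷ []) ∷
  ((# 4 , # 5) ∷ (# 1 , # 3) ∷ (# 0 , # 2) ∷ []) ∷ []

_≈?_ : ∀ {n} (π ρ : Permutation′ n) → Dec (π ≈ ρ)
π ≈? ρ = all? λ x → π ⟨$⟩ʳ x ≟ ρ ⟨$⟩ʳ x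

disjoint? : ∀ ts → Dec (Disjoint ts)
disjoint? ts = AllPairs.allPairs? (λ x y → ¬? (x ≟ y)) (entries ts)

transversal? : ∀ ι ts → Dec (Transversal ι ts)
transversal? ι ts = Pointwise.decidable _∈P?_ ts (pappusCollinearities ι)

preservesPappus? : ∀ ι σ → Dec (PreservesPappus ι σ)
preservesPappus? ι σ = All.all? (preservedBy? (σ ⟨$⟩ʳ_)) (pappusCollinearities ι)

pappusTriples-disjointTransversals : All (λ us → Disjoint us × Transversal id us) pappusTriples
pappusTriples-disjointTransversals =
  from-yes (All.all? (λ us → disjoint? us ×-dec transversal? id us) pappusTriples)

preservesPappus⇒pappusTriple : ∀ ts → Disjoint ts → 1 ≤ length ts → PreservesPappus id (prodT ts) →
  Any (λ us → prodT ts ≈ prodT us) pappusTriples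
preservesPappus⇒pappusTriple = byDisjointSearch
  (λ ts → 1 ≤? length ts →-dec (preservesPappus? id (prodT ts) →-dec
            Any.any? (λ us → prodT ts ≈? prodT us) pappusTriples)) _

transversal⇒preservesPappus : ∀ ts → Disjoint ts → Transversal id ts → PreservesPappus id (prodT ts)
transversal⇒preservesPappus =
  byDisjointSearch (λ ts → transversal? id ts →-dec preservesPappus? id (prodT ts)) _

preservesPappus⇔pappusInvolution-id : ∀ {σ} → InS σ → PreservesPappus id σ ⇔ PappusInvolution id σ
preservesPappus⇔pappusInvolution-id {σ} (ts , nonempty , disj , σ≗ts) = mk⇔ to from
  where
  to : PreservesPappus id σ → PappusInvolution id σ
  -- A with-abstraction here would make Agda normalise the search certificate.
  to pres =
    let (disj′ , transversal) , ts≈us = All.lookupAny pappusTriples-disjointTransversals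
          (preservesPappus⇒pappusTriple ts disj nonempty
            (preservesPappus-resp-≈ {id} {id} {σ} {prodT ts} (λ _ → refl) σ≗ts pres))
    in _ , (disj′ , λ x → trans (σ≗ts x) (ts≈us x)) , transversal
  from : PappusInvolution id σ → PreservesPappus id σ
  from (us , (disj′ , σ≗us) , transversal) =
    preservesPappus-resp-≈ {id} {id} {prodT us} {σ} (λ _ → refl) (sym ∘ σ≗us)
      (transversal⇒preservesPappus us disj′ transversal)

preservesPappus⇔pappusInvolution : ∀ ι {σ} → InS σ → PreservesPappus ι σ ⇔ PappusInvolution ι σ
preservesPappus⇔pappusInvolution ι {σ} inS =
  ⇔-sym (pappusInvolution-standardise ι σ) ⇔-∘
  (preservesPappus⇔pappusInvolution-id {conjugate ι σ} (inS-conjugate ι {σ} inS) ⇔-∘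
   preservesPappus-standardise ι σ)

lemma5p2 : (Col : List DPt → Set) (ι : Permutation′ 6) →
    OnlyPappusCollinearities Col ι →
    (σ : Permutation′ 6) → InS σ →
    ActsStrongly Col σ ⇔
      (∃[ a₁ ] ∃[ b₁ ] ∃[ a₂ ] ∃[ b₂ ] ∃[ a₃ ] ∃[ b₃ ]
        (IsProdDisjTransp ((a₁ , b₁) ∷ (a₂ , b₂) ∷ (a₃ , b₃) ∷ []) σ
         × (a₁ , b₁) ∈P C₁ ι × (a₂ , b₂) ∈P C₂ ι × (a₃ , b₃) ∈P C₃ ι))
lemma5p2 Col ι onlyPappus σ inS =
  mk⇔ (λ { (_ , σ≗ts , m₁ ∷ m₂ ∷ m₃ ∷ []) → _ , _ , _ , _ , _ , _ , σ≗ts , m₁ , m₂ , m₃ })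
      (λ { (_ , _ , _ , _ , _ , _ , σ≗ts , m₁ , m₂ , m₃) → _ , σ≗ts , m₁ ∷ m₂ ∷ m₃ ∷ [] })
  ⇔-∘ (preservesPappus⇔pappusInvolution ι {σ} inS ⇔-∘
       actsStrongly⇔preservesPappus {Col} {ι} {σ} onlyPappus)
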